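{- Let $G$ be a finite simple undirected connected AT-free graph of girth at least $5$, let $x,y$ be a dominating pair of $G$ with $\mathrm{dist}(x,y)$ equal to the diameter of $G$, and let $P$ be a shortest $x$-$y$ path with vertices $u_1=x,u_2,\dots,u_d=y$ in order. For $1\le i\le d$ let $S_i=\{v\in V(G)\setminus V(P) : u_i\in N_G(v)\}$. Let $v\in S_i$. Then: (1) $|N_G(v)\cap S_i|=0$ for $1\le i\le d$; (2) $|N_G(v)\cap S_{i+1}|=0$ for $1\le i\le d-1$; (3) $|N_G(v)\cap S_{i+2}|\le 1$ for $1\le i\le d-2$; (4) $|N_G(v)\cap S_j|=0$ for $i\ge 1$ and $i+3\le j\le d$.
   Context: $G$ is AT-free if it has no asteroidal triple (independent set of three vertices such that between each pair there is a path avoiding the neighbourhood of the third). A pair $x,y$ is a dominating pair if the vertex set of every $x$-$y$ path is a dominating set (every other vertex has a neighbour on the path). $N_G(v)$ is the neighbourhood of $v$. -}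

module Defs where

open import Data.Nat using (ℕ; zero; suc; _≤_; _+_)
open import Data.Fin using (Fin; zero; suc; inject₁; fromℕ; toℕ; _≟_)
open import Data.Fin.Properties using (any?)
open import Data.Fin.Subset using (Subset; _∩_; ∣_∣; _∈_)
open import Data.Vec using (tabulate)
open import Data.Bool using (Bool; true; false; not; _∧_)
open import Data.Product using (Σ; ∃; _×_; _,_)
open import Data.Sum using (_⊎_)
open import Relation.Nullary using (¬_; does)
open import Relation.Binary.PropositionalEquality using (_≡_; _≢_)

record Graph : Set where
  field
    n      : ℕ
    adj    : Fin n → Fin n → Bool
    adj-sym     : ∀ u v → adj u v ≡ adj v u
    adj-irrefl  : ∀ v → adj v v ≡ false

module _ (G : Graph) where
  open Graph G

  V : Set
  V = Fin n

  Adj : V → V → Set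
  Adj u v = adj u v ≡ true

  record Walk (k : ℕ) : Set where
    field
      seq  : Fin (suc k) → V
      step : ∀ (i : Fin k) → Adj (seq (inject₁ i)) (seq (suc i))
  open Walk public

  WalkFromTo : ∀ {k} → Walk k → V → V → Set
  WalkFromTo {k} w x y = (seq w zero ≡ x) × (seq w (fromℕ k) ≡ y)

  IsPath : ∀ {k} → Walk k → Set
  IsPath w = ∀ i j → seq w i ≡ seq w j → i ≡ j

  PathFromTo : ∀ {k} → Walk k → V → V → Set
  PathFromTo w x y = IsPath w × WalkFromTo w x y

  Connected : Set
  Connected = ∀ a b → Σ ℕ λ k → Σ (Walk k) λ w → WalkFromTo w a b

  Dist : V → V → ℕ → Set
  Dist a b d = (Σ (Walk d) λ w → WalkFromTo w a b)
             × (∀ k (w : Walk k) → WalkFromTo w a b → d ≤ k)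

  -- G has a cycle of length k (k ≥ 3): closed walk with k edges whose first k vertices are distinct.
  HasCycleOfLength : ℕ → Set
  HasCycleOfLength k = 3 ≤ k × Σ (Walk k) λ w →
       (seq w zero ≡ seq w (fromℕ k))
     × (∀ i j → seq w (inject₁ i) ≡ seq w (inject₁ j) → i ≡ j)

  GirthAtLeast : ℕ → Set
  GirthAtLeast g = ∀ k → HasCycleOfLength k → g ≤ k

  AvoidsNbhd : ∀ {k} → Walk k → V → Set
  AvoidsNbhd w c = ∀ i → ¬ Adj (seq w i) c

  IndependentTriple : V → V → V → Set
  IndependentTriple a b c =
    (a ≢ b) × (b ≢ c) × (a ≢ c) × ¬ Adj a b × ¬ Adj b c × ¬ Adj a c

  PathAvoiding : V → V → V → Set
  PathAvoiding a b c = Σ ℕ λ k → Σ (Walk k) λ w → PathFromTo w a b × AvoidsNbhd w c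

  AsteroidalTriple : V → V → V → Set
  AsteroidalTriple a b c = IndependentTriple a b c
    × PathAvoiding a b c × PathAvoiding b c a × PathAvoiding a c b

  ATFree : Set
  ATFree = ∀ a b c → ¬ AsteroidalTriple a b c

  Dominates : ∀ {k} → Walk k → Set
  Dominates w = ∀ v → (∃ λ i → seq w i ≡ v) ⊎ (∃ λ i → Adj v (seq w i))

  DominatingPair : V → V → Set
  DominatingPair x y = ∀ k (w : Walk k) → PathFromTo w x y → Dominates w

  N : V → Subset n
  N v = tabulate (adj v)

  onWalk : ∀ {k} → Walk k → V → Bool
  onWalk w v = does (any? (λ i → seq w i ≟ v))

  -- S_i = { v ∉ V(P) : u_i ∈ N_G(v) }, with u_i = seq P i (0-based index)
  S : ∀ {k} → Walk k → Fin (suc k) → Subset n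
  S P i = tabulate (λ v → not (onWalk P v) ∧ adj v (seq P i))

module Submission where

-- Let P = u_0 … u_D be a shortest x–y path and v ∈ S_i, i.e. v ∉ P and v ~ u_i.
-- A neighbour w of v lying in S_j closes a short cycle or a short detour with P:
--   (1) j = i      : v w u_i is a triangle;
--   (2) j = i + 1  : v u_i u_j w is a 4-cycle (any j with u_i ~ u_j would do);
--   (3) any j      : two distinct such neighbours w, w' give the 4-cycle v w u_j w';
--   (4) j ≥ i + 4  : u_i v w u_j is an u_i–u_j route of length 3, shorter than P;
--       j = i + 3  : u_i, u_{i+2}, w form an asteroidal triple (girth ≥ 5 and the
--                    minimality of P rule out every edge that would spoil it).

open import Defs
open import Data.Nat using (ℕ; zero; suc; _≤_; _<_; _+_; _∸_; _⊓_; s≤s; z≤n)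
open import Data.Nat.Properties
  using (≤-refl; ≤-reflexive; ≤-trans; <-≤-trans; <⇒≤; <⇒≱; n≤1+n; m≤n+m; m<n+m; m≤n⇒m<n∨m≡n;
         +-identityʳ; +-suc; +-assoc; +-comm; +-monoˡ-<; m∸n+n≡m; m+[n∸m]≡n;
         m⊓n≤n; m≤n⇒m⊓n≡m; module ≤-Reasoning)
open import Data.Fin using (Fin; zero; suc; toℕ; fromℕ; fromℕ<; inject₁; _≟_)
open import Data.Fin.Patterns using (0F; 1F; 2F; 3F)
open import Data.Fin.Properties using (any?; toℕ-injective; toℕ-fromℕ<; toℕ-fromℕ; toℕ-inject₁; toℕ≤pred[n])
open import Data.Fin.Subset using (Subset; _∩_; ∣_∣; _∈_; _∉_; _⊆_; ⁅_⁆)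
open import Data.Fin.Subset.Properties
  using (Empty-unique; ∣⊥∣≡0; nonempty?; x∈p∩q⁻; x∈⁅x⁆; ∣⁅x⁆∣≡1; p⊆q⇒∣p∣≤∣q∣)
open import Data.Vec using (tabulate)
open import Data.Vec.Properties using ([]=⇒lookup; lookup∘tabulate)
open import Data.Bool using (Bool; true; false; not; _∧_)
open import Data.Product using (_×_; _,_; proj₁; proj₂)
open import Data.Sum using (inj₁; inj₂)
open import Data.Empty using (⊥; ⊥-elim)
open import Relation.Nullary using (¬_; Dec; yes; no; does)
open import Relation.Nullary.Decidable using (decidable-stable)
open import Relation.Binary.PropositionalEquality

card-empty : ∀ {n} (p : Subset n) → (∀ x → x ∉ p) → ∣ p ∣ ≡ 0
card-empty {n} p none =
  trans (cong ∣_∣ (Empty-unique (λ (x , x∈p) → none x x∈p))) (∣⊥∣≡0 n)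

card-subsingleton : ∀ {n} (p : Subset n) → (∀ x y → x ∈ p → y ∈ p → x ≡ y) → ∣ p ∣ ≤ 1
card-subsingleton p same with nonempty? p
... | no empty = ≤-trans (≤-reflexive (card-empty p (λ x x∈p → empty (x , x∈p)))) z≤n
... | yes (x , x∈p) = ≤-trans (p⊆q⇒∣p∣≤∣q∣ p⊆⁅x⁆) (≤-reflexive (∣⁅x⁆∣≡1 x))
  where
    p⊆⁅x⁆ : p ⊆ ⁅ x ⁆
    p⊆⁅x⁆ {z} z∈p = subst (_∈ ⁅ x ⁆) (same x z x∈p z∈p) (x∈⁅x⁆ x)

∈-tabulate : ∀ {n} (f : Fin n → Bool) {x : Fin n} → x ∈ tabulate f → f x ≡ true
∈-tabulate f {x} x∈ = trans (sym (lookup∘tabulate f x)) ([]=⇒lookup x∈)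

does-false : ∀ {A : Set} (d : Dec A) → does d ≡ false → ¬ A
does-false (yes _) ()
does-false (no ¬a) _ = ¬a

injective₃ : ∀ {A : Set} (s : Fin 3 → A) → s 0F ≢ s 1F → s 1F ≢ s 2F → s 0F ≢ s 2F
           → ∀ i j → s i ≡ s j → i ≡ j
injective₃ s d01 d12 d02 = λ where
  0F 0F _ → refl
  0F 1F e → ⊥-elim (d01 e)
  0F 2F e → ⊥-elim (d02 e)
  1F 0F e → ⊥-elim (d01 (sym e))
  1F 1F _ → refl
  1F 2F e → ⊥-elim (d12 e)
  2F 0F e → ⊥-elim (d02 (sym e))
  2F 1F e → ⊥-elim (d12 (sym e))
  2F 2F _ → refl

injective₄ : ∀ {A : Set} (s : Fin 4 → A)
           → s 0F ≢ s 1F → s 1F ≢ s 2F → s 2F ≢ s 3F → s 0F ≢ s 3F → s 0F ≢ s 2F → s 1F ≢ s 3F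
           → ∀ i j → s i ≡ s j → i ≡ j
injective₄ s d01 d12 d23 d03 d02 d13 = λ where
  0F 0F _ → refl
  0F 1F e → ⊥-elim (d01 e)
  0F 2F e → ⊥-elim (d02 e)
  0F 3F e → ⊥-elim (d03 e)
  1F 0F e → ⊥-elim (d01 (sym e))
  1F 1F _ → refl
  1F 2F e → ⊥-elim (d12 e)
  1F 3F e → ⊥-elim (d13 e)
  2F 0F e → ⊥-elim (d02 (sym e))
  2F 1F e → ⊥-elim (d12 (sym e))
  2F 2F _ → refl
  2F 3F e → ⊥-elim (d23 e)
  3F 0F e → ⊥-elim (d03 (sym e))
  3F 1F e → ⊥-elim (d13 (sym e))
  3F 2F e → ⊥-elim (d23 (sym e))
  3F 3F _ → refl

module Graphs (G : Graph) where
  open Graph G using (adj-sym; adj-irrefl)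

  infix 4 _~_
  _~_ : V G → V G → Set
  _~_ = Adj G

  ~-sym : ∀ {a b} → a ~ b → b ~ a
  ~-sym {a} {b} a~b = trans (adj-sym b a) a~b

  ≁-sym : ∀ {a b} → ¬ a ~ b → ¬ b ~ a
  ≁-sym a≁b b~a = a≁b (~-sym b~a)

  ~⇒≢ : ∀ {a b} → a ~ b → a ≢ b
  ~⇒≢ {a} a~a refl with trans (sym a~a) (adj-irrefl a)
  ... | ()

  -- A route from a to b with k edges; unlike Walk it composes by concatenation.
  infixr 5 _∷_ _++_
  data Route : V G → V G → ℕ → Set where
    []  : ∀ {a} → Route a a 0
    _∷_ : ∀ {a b c k} → a ~ b → Route b c k → Route a c (suc k)

  vertex : ∀ {a b k} → Route a b k → Fin (suc k) → V G
  vertex {a} _ zero = a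
  vertex (_ ∷ r) (suc t) = vertex r t

  vertex-last : ∀ {a b k} (r : Route a b k) → vertex r (fromℕ k) ≡ b
  vertex-last [] = refl
  vertex-last (_ ∷ r) = vertex-last r

  vertex-step : ∀ {a b k} (r : Route a b k) (t : Fin k) → vertex r (inject₁ t) ~ vertex r (suc t)
  vertex-step (_∷_ {b = b} a~b r) zero = subst (_ ~_) (sym (vertex-first r)) a~b
    where
      vertex-first : ∀ {c k} (r : Route b c k) → vertex r zero ≡ b
      vertex-first [] = refl
      vertex-first (_ ∷ _) = refl
  vertex-step (_ ∷ r) (suc t) = vertex-step r t

  walkOf : ∀ {a b k} → Route a b k → Walk G k
  walkOf r = record { seq = vertex r ; step = vertex-step r }

  walkOf-ends : ∀ {a b k} (r : Route a b k) → WalkFromTo G (walkOf r) a b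
  walkOf-ends r = refl , vertex-last r

  _++_ : ∀ {a b c m k} → Route a b m → Route b c k → Route a c (m + k)
  [] ++ r = r
  (e ∷ q) ++ r = e ∷ (q ++ r)

  ≡-route : ∀ {a b} → a ≡ b → Route a b 0
  ≡-route refl = []

  triangle : ∀ {a b c} → a ~ b → b ~ c → c ~ a → HasCycleOfLength G 3
  triangle a~b b~c c~a = s≤s (s≤s (s≤s z≤n)) , walkOf r , refl ,
    injective₃ (λ t → vertex r (inject₁ t)) (~⇒≢ a~b) (~⇒≢ b~c) (≢-sym (~⇒≢ c~a))
    where r = a~b ∷ b~c ∷ c~a ∷ []

  square : ∀ {a b c d} → a ~ b → b ~ c → c ~ d → d ~ a → a ≢ c → b ≢ d
         → HasCycleOfLength G 4
  square a~b b~c c~d d~a a≢c b≢d = s≤s (s≤s (s≤s z≤n)) , walkOf r , refl ,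
    injective₄ (λ t → vertex r (inject₁ t))
      (~⇒≢ a~b) (~⇒≢ b~c) (~⇒≢ c~d) (≢-sym (~⇒≢ d~a)) a≢c b≢d
    where r = a~b ∷ b~c ∷ c~d ∷ d~a ∷ []

  path₃ : ∀ {a b c} → a ~ b → b ~ c → a ≢ c → (z : V G)
        → ¬ a ~ z → ¬ b ~ z → ¬ c ~ z → PathAvoiding G a c z
  path₃ a~b b~c a≢c z a≁z b≁z c≁z =
    2 , walkOf r , (injective₃ (vertex r) (~⇒≢ a~b) (~⇒≢ b~c) a≢c , walkOf-ends r) , avoids
    where
      r = a~b ∷ b~c ∷ []
      avoids : AvoidsNbhd G (walkOf r) z
      avoids 0F = a≁z
      avoids 1F = b≁z
      avoids 2F = c≁z

module GirthFive (G : Graph) (girth : GirthAtLeast G 5) where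

  no-triangle : ¬ HasCycleOfLength G 3
  no-triangle c with girth 3 c
  ... | s≤s (s≤s (s≤s ()))

  no-square : ¬ HasCycleOfLength G 4
  no-square c with girth 4 c
  ... | s≤s (s≤s (s≤s (s≤s ())))

module AlongWalk (G : Graph) {D : ℕ} (P : Walk G D) where
  open Graphs G

  u : Fin (suc D) → V G
  u = seq P

  OffP : V G → Set
  OffP w = ∀ k → u k ≢ w

  S-member : ∀ {j w} → w ∈ S G P j → OffP w × w ~ u j
  S-member {j} {w} w∈S = off (onWalk G P w) refl adjacent
    where
      off : ∀ b → onWalk G P w ≡ b → not b ∧ Graph.adj G w (u j) ≡ true → OffP w × w ~ u j
      off false notOn w~uⱼ = (λ k uₖ≡w → does-false (any? (λ i → u i ≟ w)) notOn (k , uₖ≡w)) , w~uⱼ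
      off true _ ()
      adjacent : not (onWalk G P w) ∧ Graph.adj G w (u j) ≡ true
      adjacent = ∈-tabulate _ w∈S

  no-neighbour-in-S : ∀ v j → (∀ w → v ~ w → OffP w → w ~ u j → ⊥)
                    → ∣ N G v ∩ S G P j ∣ ≡ 0
  no-neighbour-in-S v j none = card-empty _ λ w w∈ →
    let (w∈N , w∈S) = x∈p∩q⁻ (N G v) (S G P j) w∈
        (w-off , w~uⱼ) = S-member w∈S
    in none w (∈-tabulate _ w∈N) w-off w~uⱼ

  unique-neighbour-in-S : ∀ v j → (∀ w w' → v ~ w → v ~ w' → w ~ u j → w' ~ u j → w ≡ w')
                        → ∣ N G v ∩ S G P j ∣ ≤ 1
  unique-neighbour-in-S v j same = card-subsingleton _ λ w w' w∈ w'∈ →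
    let (w∈N , w∈S) = x∈p∩q⁻ (N G v) (S G P j) w∈
        (w'∈N , w'∈S) = x∈p∩q⁻ (N G v) (S G P j) w'∈
    in same w w' (∈-tabulate _ w∈N) (∈-tabulate _ w'∈N)
         (proj₂ (S-member w∈S)) (proj₂ (S-member w'∈S))

  -- The t-th vertex of P for t : ℕ (clamped to the last vertex), convenient for arithmetic.
  at : ℕ → V G
  at t = u (fromℕ< (s≤s (m⊓n≤n t D)))

  at-toℕ : ∀ a {t} → toℕ a ≡ t → at t ≡ u a
  at-toℕ a refl = cong u (toℕ-injective (trans (toℕ-fromℕ< _) (m≤n⇒m⊓n≡m (toℕ≤pred[n] a))))

  at-step : ∀ t → t < D → at t ~ at (suc t)
  at-step t t<D = subst₂ _~_
    (sym (at-toℕ (inject₁ i) (trans (toℕ-inject₁ i) (toℕ-fromℕ< t<D))))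
    (sym (at-toℕ (suc i) (cong suc (toℕ-fromℕ< t<D))))
    (step P i)
    where i = fromℕ< t<D

  at-off : ∀ {w} → OffP w → ∀ t → at t ≢ w
  at-off w-off t = w-off _

  consecutive-adjacent : ∀ i j → toℕ j ≡ suc (toℕ i) → u i ~ u j
  consecutive-adjacent i j j≡1+i = subst₂ _~_ (at-toℕ i refl) (at-toℕ j j≡1+i)
    (at-step (toℕ i) (subst (_≤ D) j≡1+i (toℕ≤pred[n] j)))

module SmallGirthParts (G : Graph) (girth : GirthAtLeast G 5) {D : ℕ} (P : Walk G D) where
  open Graphs G
  open GirthFive G girth
  open AlongWalk G P

  S-independent : ∀ {v i} → v ~ u i → ∣ N G v ∩ S G P i ∣ ≡ 0
  S-independent v~uᵢ = no-neighbour-in-S _ _ λ w v~w _ w~uᵢ →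
    no-triangle (triangle v~w w~uᵢ (~-sym v~uᵢ))

  S-no-edge-to-adjacent : ∀ {v i j} → OffP v → v ~ u i → u i ~ u j → ∣ N G v ∩ S G P j ∣ ≡ 0
  S-no-edge-to-adjacent {i = i} {j} v-off v~uᵢ uᵢ~uⱼ = no-neighbour-in-S _ _ λ w v~w w-off w~uⱼ →
    no-square (square v~uᵢ uᵢ~uⱼ (~-sym w~uⱼ) (~-sym v~w) (λ v≡uⱼ → v-off j (sym v≡uⱼ)) (w-off i))

  S-at-most-one : ∀ {v j} → OffP v → ∣ N G v ∩ S G P j ∣ ≤ 1
  S-at-most-one {j = j} v-off = unique-neighbour-in-S _ _ λ w w' v~w v~w' w~uⱼ w'~uⱼ →
    decidable-stable (w ≟ w') λ w≢w' →
      no-square (square v~w w~uⱼ (~-sym w'~uⱼ) (~-sym v~w') (λ v≡uⱼ → v-off j (sym v≡uⱼ)) w≢w')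

module Geodesic (G : Graph) (girth : GirthAtLeast G 5) {x y : V G} {D : ℕ}
                (dist : Dist G x y D) (P : Walk G D) (ends : WalkFromTo G P x y) where
  open Graphs G
  open GirthFive G girth
  open AlongWalk G P

  route-length : ∀ {k} → Route x y k → D ≤ k
  route-length {k} r = proj₂ dist k (walkOf r) (walkOf-ends r)

  segment : ∀ k s t → k + s ≡ t → t ≤ D → Route (at s) (at t) k
  segment zero s .s refl _ = []
  segment (suc k) s t 1+k+s≡t t≤D =
    at-step s (<-≤-trans (subst (s <_) 1+k+s≡t (s≤s (m≤n+m s k))) t≤D)
    ∷ segment k (suc s) t (trans (+-suc k s) 1+k+s≡t) t≤D

  no-shortcut : ∀ {m} s t → m + s < t → t ≤ D → ¬ Route (at s) (at t) m
  no-shortcut {m} s t m+s<t t≤D r = <⇒≱ shorter (route-length (prefix ++ r ++ suffix))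
    where
      s≤D : s ≤ D
      s≤D = ≤-trans (m≤n+m s m) (<⇒≤ (<-≤-trans m+s<t t≤D))
      prefix : Route x (at s) s
      prefix = subst (λ z → Route z (at s) s) (trans (at-toℕ 0F refl) (proj₁ ends))
                 (segment s 0 s (+-identityʳ s) s≤D)
      suffix : Route (at t) y (D ∸ t)
      suffix = subst (λ z → Route (at t) z (D ∸ t)) (trans (at-toℕ (fromℕ D) (toℕ-fromℕ D)) (proj₂ ends))
                 (segment (D ∸ t) t D (m∸n+n≡m t≤D) ≤-refl)
      shorter : s + (m + (D ∸ t)) < D
      shorter = begin-strict
        s + (m + (D ∸ t))   ≡⟨ sym (+-assoc s m (D ∸ t)) ⟩
        (s + m) + (D ∸ t)   ≡⟨ cong (_+ (D ∸ t)) (+-comm s m) ⟩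
        (m + s) + (D ∸ t)   <⟨ +-monoˡ-< (D ∸ t) m+s<t ⟩
        t + (D ∸ t)         ≡⟨ m+[n∸m]≡n t≤D ⟩
        D                   ∎
        where open ≤-Reasoning

  at-injective : ∀ s t → s < t → t ≤ D → at s ≢ at t
  at-injective s t s<t t≤D eq = no-shortcut s t s<t t≤D (≡-route eq)

  at-nonadjacent : ∀ s t → suc s < t → t ≤ D → ¬ at s ~ at t
  at-nonadjacent s t 1+s<t t≤D e = no-shortcut s t 1+s<t t≤D (e ∷ [])

  S-far : ∀ {v i j} → v ~ u i → 3 + toℕ i < toℕ j → ∣ N G v ∩ S G P j ∣ ≡ 0
  S-far {v} {i} {j} v~uᵢ i+3<j = no-neighbour-in-S _ _ λ w v~w _ w~uⱼ →
    no-shortcut (toℕ i) (toℕ j) i+3<j (toℕ≤pred[n] j)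
      (subst (_~ v) (sym (at-toℕ i refl)) (~-sym v~uᵢ)
       ∷ v~w
       ∷ subst (w ~_) (sym (at-toℕ j refl)) w~uⱼ
       ∷ [])

  -- j = i + 3: with A = u_i, B = u_{i+1}, C = u_{i+2}, E = u_{i+3}, the route A v w E
  -- makes A, C, w an asteroidal triple, via the paths A B C, C E w and A v w.
  gap-three : ATFree G → ∀ {v w} a → 3 + a ≤ D → OffP v → OffP w
            → at a ~ v → v ~ w → w ~ at (3 + a) → ⊥
  gap-three atFree {v} {w} a 3+a≤D v-off w-off A~v v~w w~E =
    atFree A C w ((A≢C , C≢w , A≢w , A≁C , C≁w , A≁w) , pathAC , pathCw , pathAw)
    where
      A = at a
      B = at (1 + a)
      C = at (2 + a)
      E = at (3 + a)
      A~B : A ~ B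
      A~B = at-step a (≤-trans (m≤n+m (1 + a) 2) 3+a≤D)
      B~C : B ~ C
      B~C = at-step (1 + a) (≤-trans (m≤n+m (2 + a) 1) 3+a≤D)
      C~E : C ~ E
      C~E = at-step (2 + a) 3+a≤D
      A≢C : A ≢ C
      A≢C = at-injective a (2 + a) (m<n+m a (s≤s z≤n)) (≤-trans (m≤n+m (2 + a) 1) 3+a≤D)
      A≁C : ¬ A ~ C
      A≁C = at-nonadjacent a (2 + a) ≤-refl (≤-trans (m≤n+m (2 + a) 1) 3+a≤D)
      A≁E : ¬ A ~ E
      A≁E = at-nonadjacent a (3 + a) (n≤1+n (2 + a)) 3+a≤D
      A≢w = at-off w-off a
      C≢w = at-off w-off (2 + a)
      A≁w : ¬ A ~ w
      A≁w A~w = no-triangle (triangle A~v v~w (~-sym A~w))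
      C≁w : ¬ C ~ w
      C≁w C~w = no-triangle (triangle C~E (~-sym w~E) (~-sym C~w))
      B≁w : ¬ B ~ w
      B≁w B~w = no-square (square A~B B~w (~-sym v~w) (~-sym A~v) A≢w (at-off v-off (1 + a)))
      v≁C : ¬ v ~ C
      v≁C v~C = no-square (square v~C C~E (~-sym w~E) (~-sym v~w)
                             (λ v≡E → at-off v-off (3 + a) (sym v≡E)) C≢w)
      pathAC : PathAvoiding G A C w
      pathAC = path₃ A~B B~C A≢C w A≁w B≁w C≁w
      pathCw : PathAvoiding G C w A
      pathCw = path₃ C~E (~-sym w~E) C≢w A (≁-sym A≁C) (≁-sym A≁E) (≁-sym A≁w)
      pathAw : PathAvoiding G A w C
      pathAw = path₃ A~v v~w A≢w C A≁C v≁C (≁-sym C≁w)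

  S-beyond-two : ATFree G → ∀ {v i j} → OffP v → v ~ u i → toℕ i + 3 ≤ toℕ j
               → ∣ N G v ∩ S G P j ∣ ≡ 0
  S-beyond-two atFree {v} {i} {j} v-off v~uᵢ i+3≤j
    with m≤n⇒m<n∨m≡n (subst (_≤ toℕ j) (+-comm (toℕ i) 3) i+3≤j)
  ... | inj₁ i+3<j = S-far v~uᵢ i+3<j
  ... | inj₂ i+3≡j = no-neighbour-in-S _ _ λ w v~w w-off w~uⱼ →
    gap-three atFree (toℕ i) (subst (_≤ D) (sym i+3≡j) (toℕ≤pred[n] j)) v-off w-off
      (subst (_~ v) (sym (at-toℕ i refl)) (~-sym v~uᵢ))
      v~w
      (subst (w ~_) (sym (at-toℕ j (sym i+3≡j))) w~uⱼ)

lemma3 : (G : Graph) → Connected G → ATFree G → GirthAtLeast G 5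
    → (x y : V G) → DominatingPair G x y
    → (D : ℕ) → Dist G x y D → (∀ a b k → Dist G a b k → k ≤ D)
    → (P : Walk G D) → PathFromTo G P x y
    → (i : Fin (suc D)) → (v : V G) → v ∈ S G P i
    → (∣ N G v ∩ S G P i ∣ ≡ 0)
      × (∀ (j : Fin (suc D)) → toℕ j ≡ toℕ i + 1 → ∣ N G v ∩ S G P j ∣ ≡ 0)
      × (∀ (j : Fin (suc D)) → toℕ j ≡ toℕ i + 2 → ∣ N G v ∩ S G P j ∣ ≤ 1)
      × (∀ (j : Fin (suc D)) → toℕ i + 3 ≤ toℕ j → ∣ N G v ∩ S G P j ∣ ≡ 0)
lemma3 G _ atFree girth _ _ _ _ dist _ P (_ , ends) i v v∈Sᵢ =
    S-independent v~uᵢ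
  , (λ j j≡i+1 → S-no-edge-to-adjacent v-off v~uᵢ
                   (consecutive-adjacent i j (trans j≡i+1 (+-comm (toℕ i) 1))))
  , (λ j _ → S-at-most-one v-off)
  , (λ j → S-beyond-two atFree v-off v~uᵢ)
  where
    open AlongWalk G P
    open SmallGirthParts G girth P
    open Geodesic G girth dist P ends
    v-off : OffP v
    v-off = proj₁ (S-member v∈Sᵢ)
    v~uᵢ : Adj G v (u i)
    v~uᵢ = proj₂ (S-member v∈Sᵢ)
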